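{- Let $n\ge0$, let $x+yi\in Oct_n$ be nonzero, and let $l\ge0$ be such that $2^l\parallel\gcd(x,y)$. If $l\neq\lfloor n/2\rfloor+1$, then $l\le\lfloor n/2\rfloor$ and $x+yi\in B_{n+1}$.
   Context: For $k\ge0$, $w_{2k}=3\cdot2^k$, $w_{2k+1}=4\cdot2^k$. $Oct_n=\{x+yi\in\mathbb{Z}[i]: |x|,|y|\le w_n-2,\ |x|+|y|\le w_{n+1}-3\}$. $B_n=\{\sum_{j=0}^n v_j(1+i)^j: v_j\in\{0,\pm1,\pm i\}\}$. $2^l\parallel m$ means $2^l\mid m$ and $2^{l+1}\nmid m$. -}

module Defs where

open import Data.Nat as ℕ using (ℕ; zero; suc)
open import Data.Integer as ℤ using (ℤ; +_; _+_; _-_; _*_; -_; ∣_∣; _≤_)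
open import Data.Integer.Divisibility using (_∣_)
open import Data.Integer.GCD using (gcd)
import Data.Fin
open Data.Fin using (Fin)
open import Data.Product using (_×_; _,_; Σ; ∃)
open import Relation.Nullary using (¬_)
open import Relation.Binary.PropositionalEquality using (_≡_)

ℤ[i] : Set
ℤ[i] = ℤ × ℤ

re : ℤ[i] → ℤ
re (x , _) = x

im : ℤ[i] → ℤ
im (_ , y) = y

0ᵍ : ℤ[i]
0ᵍ = (+ 0 , + 0)

_+ᵍ_ : ℤ[i] → ℤ[i] → ℤ[i]
(a , b) +ᵍ (c , d) = (a + c , b + d)

_*ᵍ_ : ℤ[i] → ℤ[i] → ℤ[i]
(a , b) *ᵍ (c , d) = (a * c - b * d , a * d + b * c)

1+i^ : ℕ → ℤ[i]
1+i^ zero    = (+ 1 , + 0)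
1+i^ (suc j) = (+ 1 , + 1) *ᵍ 1+i^ j

w : ℕ → ℕ
w n with n ℕ.% 2
... | 0 = 3 ℕ.* 2 ℕ.^ ℕ.⌊ n /2⌋
... | _ = 4 ℕ.* 2 ℕ.^ ℕ.⌊ n /2⌋

Oct : ℕ → ℤ[i] → Set
Oct n (x , y) =
  (+ ∣ x ∣ ≤ + w n - + 2) × (+ ∣ y ∣ ≤ + w n - + 2) ×
  (+ ∣ x ∣ + + ∣ y ∣ ≤ + w (suc n) - + 3)

data Digit : Set where
  d0 d1 d-1 di d-i : Digit

digit : Digit → ℤ[i]
digit d0  = (+ 0 , + 0)
digit d1  = (+ 1 , + 0)
digit d-1 = (- + 1 , + 0)
digit di  = (+ 0 , + 1)
digit d-i = (+ 0 , - + 1)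

expand : (n : ℕ) → (Fin (suc n) → Digit) → ℤ[i]
expand zero    v = digit (v Data.Fin.zero) *ᵍ 1+i^ 0
expand (suc n) v = expand n (λ j → v (Data.Fin.inject₁ j))
                   +ᵍ (digit (v (Data.Fin.fromℕ (suc n))) *ᵍ 1+i^ (suc n))

B : ℕ → ℤ[i] → Set
B n z = Σ (Fin (suc n) → Digit) λ v → expand n v ≡ z

_∥_ : ℕ → ℤ → Set
l ∥ m = ((+ (2 ℕ.^ l)) ∣ m) × ¬ ((+ (2 ℕ.^ suc l)) ∣ m)

-- B (k + 1) consists of the sums z + d (1 + i)^(k + 1) with z ∈ B k and d a digit.  As
-- (1 + i)² = 2i, the power (1 + i)^(2m) is a unit times 2^m and (1 + i)^(2m + 1) a unit
-- times 2^m (1 + i), so such a step moves z by ±2^m along an axis or by (±2^m, ±2^m), and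
-- every direction is available.  Measured in (|x|, |y|), each point of the octagon at one
-- level either lies in the octagon one level down or is moved into it by the step towards
-- the origin, so induction on the level covers Oct n by B (n + 1) once the points with
-- 2^(⌊n/2⌋+1) ∣ gcd(x, y) are set aside.  For the remaining points |x|, |y| < 2^(⌊n/2⌋+2)
-- forces l ≤ ⌊n/2⌋.

module Submission where

open import Defs
open import Data.Nat as ℕ
  using (ℕ; zero; suc; _+_; _*_; _∸_; _^_; _≤_; _<_; _≤?_; _<?_; z≤n; s≤s; ⌊_/2⌋; _%_)
open import Data.Nat.Properties
open import Data.Nat.Divisibility using (_∣_; ∣⇒≤; ∣-refl; ∣-trans; ∣-antisym; m∣m*n)
open import Data.Nat.GCD using (gcd[m,n]∣m; gcd[m,n]∣n; gcd-greatest; gcd-identityˡ; gcd-identityʳ)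
import Data.Nat.GCD as ℕ
open import Data.Nat.Tactic.RingSolver using (solve-∀)
open import Data.Integer as ℤ using (ℤ; +_; -[1+_]; ∣_∣; sign; _◃_; _⊖_)
import Data.Integer.Properties as ℤP
import Data.Integer.Tactic.RingSolver as ℤ-Solver
open import Data.Integer.GCD using (gcd)
open import Data.Sign as Sign using (opposite)
open import Data.Sign.Properties using (opposite-involutive)
open import Data.Fin using (zero; suc; inject₁; fromℕ)
open import Data.Vec.Functional using (Vector; init; last; tail)
open import Data.Product using (_×_; _,_; Σ; swap)
open import Data.Sum using (_⊎_; inj₁; inj₂; [_,_]; map; map₂)
open import Data.Empty using (⊥-elim)
open import Function using (_∘_)
open import Relation.Nullary using (¬_; yes; no)
open import Relation.Binary.PropositionalEquality
  using (_≡_; _≢_; refl; sym; trans; cong; cong₂; subst; subst₂; _≗_; module ≡-Reasoning)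

*ᵍ-identityʳ : ∀ z → z *ᵍ (+ 1 , + 0) ≡ z
*ᵍ-identityʳ (a , b) = cong₂ _,_ (re≡ a b) (im≡ a b)
  where
  re≡ : ∀ a b → a ℤ.* + 1 ℤ.- b ℤ.* + 0 ≡ a
  re≡ = ℤ-Solver.solve-∀
  im≡ : ∀ a b → a ℤ.* + 0 ℤ.+ b ℤ.* + 1 ≡ b
  im≡ = ℤ-Solver.solve-∀

*ᵍ-swap : ∀ u v z → u *ᵍ (v *ᵍ z) ≡ v *ᵍ (u *ᵍ z)
*ᵍ-swap (a , b) (c , d) (e , f) = cong₂ _,_ (re≡ a b c d e f) (im≡ a b c d e f)
  where
  re≡ : ∀ a b c d e f →
        a ℤ.* (c ℤ.* e ℤ.- d ℤ.* f) ℤ.- b ℤ.* (c ℤ.* f ℤ.+ d ℤ.* e) ≡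
        c ℤ.* (a ℤ.* e ℤ.- b ℤ.* f) ℤ.- d ℤ.* (a ℤ.* f ℤ.+ b ℤ.* e)
  re≡ = ℤ-Solver.solve-∀
  im≡ : ∀ a b c d e f →
        a ℤ.* (c ℤ.* f ℤ.+ d ℤ.* e) ℤ.+ b ℤ.* (c ℤ.* e ℤ.- d ℤ.* f) ≡
        c ℤ.* (a ℤ.* f ℤ.+ b ℤ.* e) ℤ.+ d ℤ.* (a ℤ.* e ℤ.- b ℤ.* f)
  im≡ = ℤ-Solver.solve-∀

1+i*ᵍ : ∀ a b → (+ 1 , + 1) *ᵍ (a , b) ≡ (a ℤ.- b , a ℤ.+ b)
1+i*ᵍ a b = cong₂ _,_ (re≡ a b) (im≡ a b)
  where
  re≡ : ∀ a b → + 1 ℤ.* a ℤ.- + 1 ℤ.* b ≡ a ℤ.- b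
  re≡ = ℤ-Solver.solve-∀
  im≡ : ∀ a b → + 1 ℤ.* b ℤ.+ + 1 ℤ.* a ≡ a ℤ.+ b
  im≡ = ℤ-Solver.solve-∀

[1+i]²*ᵍ : ∀ a b → (+ 1 , + 1) *ᵍ ((+ 1 , + 1) *ᵍ (a , b)) ≡ (ℤ.- (b ℤ.+ b) , a ℤ.+ a)
[1+i]²*ᵍ a b = trans (cong ((+ 1 , + 1) *ᵍ_) (1+i*ᵍ a b))
  (trans (1+i*ᵍ (a ℤ.- b) (a ℤ.+ b)) (cong₂ _,_ (re≡ a b) (im≡ a b)))
  where
  re≡ : ∀ a b → (a ℤ.- b) ℤ.- (a ℤ.+ b) ≡ ℤ.- (b ℤ.+ b)
  re≡ = ℤ-Solver.solve-∀
  im≡ : ∀ a b → (a ℤ.- b) ℤ.+ (a ℤ.+ b) ≡ a ℤ.+ a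
  im≡ = ℤ-Solver.solve-∀

_*ᵈ_ : Digit → ℤ[i] → ℤ[i]
d0  *ᵈ _       = 0ᵍ
d1  *ᵈ z       = z
d-1 *ᵈ (a , b) = (ℤ.- a , ℤ.- b)
di  *ᵈ (a , b) = (ℤ.- b , a)
d-i *ᵈ (a , b) = (b , ℤ.- a)

digit-*ᵍ : ∀ d z → digit d *ᵍ z ≡ d *ᵈ z
digit-*ᵍ d0  (a , b) = refl
digit-*ᵍ d1  (a , b) = cong₂ _,_ (re≡ a b) (im≡ a b)
  where
  re≡ : ∀ a b → + 1 ℤ.* a ℤ.- + 0 ℤ.* b ≡ a
  re≡ = ℤ-Solver.solve-∀
  im≡ : ∀ a b → + 1 ℤ.* b ℤ.+ + 0 ℤ.* a ≡ b
  im≡ = ℤ-Solver.solve-∀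
digit-*ᵍ d-1 (a , b) = cong₂ _,_ (re≡ a b) (im≡ a b)
  where
  re≡ : ∀ a b → ℤ.- + 1 ℤ.* a ℤ.- + 0 ℤ.* b ≡ ℤ.- a
  re≡ = ℤ-Solver.solve-∀
  im≡ : ∀ a b → ℤ.- + 1 ℤ.* b ℤ.+ + 0 ℤ.* a ≡ ℤ.- b
  im≡ = ℤ-Solver.solve-∀
digit-*ᵍ di  (a , b) = cong₂ _,_ (re≡ a b) (im≡ a b)
  where
  re≡ : ∀ a b → + 0 ℤ.* a ℤ.- + 1 ℤ.* b ≡ ℤ.- b
  re≡ = ℤ-Solver.solve-∀
  im≡ : ∀ a b → + 0 ℤ.* b ℤ.+ + 1 ℤ.* a ≡ a
  im≡ = ℤ-Solver.solve-∀
digit-*ᵍ d-i (a , b) = cong₂ _,_ (re≡ a b) (im≡ a b)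
  where
  re≡ : ∀ a b → + 0 ℤ.* a ℤ.- ℤ.- + 1 ℤ.* b ≡ b
  re≡ = ℤ-Solver.solve-∀
  im≡ : ∀ a b → + 0 ℤ.* b ℤ.+ ℤ.- + 1 ℤ.* a ≡ ℤ.- a
  im≡ = ℤ-Solver.solve-∀

neg-◃ : ∀ σ n → ℤ.- (σ ◃ n) ≡ opposite σ ◃ n
neg-◃ Sign.+ n = trans (cong ℤ.-_ (ℤP.+◃n≡+n n)) (sym (ℤP.-◃n≡-n n))
neg-◃ Sign.- n =
  trans (cong ℤ.-_ (ℤP.-◃n≡-n n)) (trans (ℤP.neg-involutive (+ n)) (sym (ℤP.+◃n≡+n n)))

◃-double : ∀ σ n → (σ ◃ n) ℤ.+ (σ ◃ n) ≡ σ ◃ (2 * n)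
◃-double σ n = trans (sym (ℤP.◃-distrib-+ σ n n)) (cong (λ k → σ ◃ (n + k)) (sym (+-identityʳ n)))

same-or-opposite : ∀ σ τ → τ ≡ σ ⊎ τ ≡ opposite σ
same-or-opposite Sign.+ Sign.+ = inj₁ refl
same-or-opposite Sign.+ Sign.- = inj₂ refl
same-or-opposite Sign.- Sign.+ = inj₂ refl
same-or-opposite Sign.- Sign.- = inj₁ refl

-- Axial and diagonal points

data Axial (k : ℕ) : ℤ[i] → Set where
  real : ∀ σ → Axial k (σ ◃ k , + 0)
  imag : ∀ σ → Axial k (+ 0 , σ ◃ k)

private
  by-digit : ∀ d {z t} → d *ᵈ z ≡ t → Σ Digit λ e → digit e *ᵍ z ≡ t
  by-digit d {z} eq = d , trans (digit-*ᵍ d z) eq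

axial-digit : ∀ {k z t} → Axial k z → Axial k t → Σ Digit λ d → digit d *ᵍ z ≡ t
axial-digit {k} (real σ) (real τ) with same-or-opposite σ τ
... | inj₁ refl = by-digit d1 refl
... | inj₂ refl = by-digit d-1 (cong (_, + 0) (neg-◃ σ k))
axial-digit {k} (real σ) (imag τ) with same-or-opposite σ τ
... | inj₁ refl = by-digit di refl
... | inj₂ refl = by-digit d-i (cong (+ 0 ,_) (neg-◃ σ k))
axial-digit {k} (imag σ) (real τ) with same-or-opposite σ τ
... | inj₁ refl = by-digit d-i refl
... | inj₂ refl = by-digit di (cong (_, + 0) (neg-◃ σ k))
axial-digit {k} (imag σ) (imag τ) with same-or-opposite σ τ
... | inj₁ refl = by-digit d1 refl
... | inj₂ refl = by-digit d-1 (cong (+ 0 ,_) (neg-◃ σ k))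

[1+i]²-axial : ∀ {k z} → Axial k z → Axial (2 * k) ((+ 1 , + 1) *ᵍ ((+ 1 , + 1) *ᵍ z))
[1+i]²-axial {k} (real σ) = subst (Axial (2 * k))
  (sym (trans ([1+i]²*ᵍ (σ ◃ k) (+ 0)) (cong (+ 0 ,_) (◃-double σ k))))
  (imag σ)
[1+i]²-axial {k} (imag σ) = subst (Axial (2 * k))
  (sym (trans ([1+i]²*ᵍ (+ 0) (σ ◃ k))
              (cong (_, + 0) (trans (cong ℤ.-_ (◃-double σ k)) (neg-◃ σ (2 * k))))))
  (real (opposite σ))

double : ℕ → ℕ
double zero    = zero
double (suc m) = suc (suc (double m))

1+i^double-axial : ∀ m → Axial (2 ^ m) (1+i^ (double m))
1+i^double-axial zero    = real Sign.+
1+i^double-axial (suc m) = [1+i]²-axial (1+i^double-axial m)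

diagonal≡[1+i]axial : ∀ {k} σ τ → Σ ℤ[i] λ t → Axial k t × (+ 1 , + 1) *ᵍ t ≡ (σ ◃ k , τ ◃ k)
diagonal≡[1+i]axial {k} σ τ with same-or-opposite σ τ
... | inj₁ refl = (σ ◃ k , + 0) , real σ ,
  trans (1+i*ᵍ (σ ◃ k) (+ 0)) (cong₂ _,_ (ℤP.+-identityʳ _) (ℤP.+-identityʳ _))
... | inj₂ refl = (+ 0 , opposite σ ◃ k) , imag (opposite σ) ,
  trans (1+i*ᵍ (+ 0) (opposite σ ◃ k))
        (cong₂ _,_ (trans (ℤP.+-identityˡ _) (trans (neg-◃ (opposite σ) k)
                                                      (cong (_◃ k) (opposite-involutive σ))))
                   (ℤP.+-identityˡ _))

diagonal-digit : ∀ {k z} → Axial k z → ∀ σ τ →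
                 Σ Digit λ d → digit d *ᵍ ((+ 1 , + 1) *ᵍ z) ≡ (σ ◃ k , τ ◃ k)
diagonal-digit {k} {z} Z σ τ =
  let t , T , [1+i]t≡ = diagonal≡[1+i]axial σ τ
      d , dz≡t = axial-digit Z T
  in d , (begin
    digit d *ᵍ ((+ 1 , + 1) *ᵍ z)  ≡⟨ *ᵍ-swap (digit d) (+ 1 , + 1) z ⟩
    (+ 1 , + 1) *ᵍ (digit d *ᵍ z)  ≡⟨ cong ((+ 1 , + 1) *ᵍ_) dz≡t ⟩
    (+ 1 , + 1) *ᵍ t               ≡⟨ [1+i]t≡ ⟩
    (σ ◃ k , τ ◃ k)                ∎)
  where open ≡-Reasoning

_∷ʳ_ : ∀ {A : Set} {n} → Vector A n → A → Vector A (suc n)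
_∷ʳ_ {n = zero}  v x _       = x
_∷ʳ_ {n = suc _} v x zero    = v zero
_∷ʳ_ {n = suc _} v x (suc j) = (tail v ∷ʳ x) j

init-∷ʳ : ∀ {A : Set} {n} (v : Vector A n) x → init (v ∷ʳ x) ≗ v
init-∷ʳ {n = suc _} v x zero    = refl
init-∷ʳ {n = suc _} v x (suc j) = init-∷ʳ (tail v) x j

last-∷ʳ : ∀ {A : Set} {n} (v : Vector A n) x → last (v ∷ʳ x) ≡ x
last-∷ʳ {n = zero}  v x = refl
last-∷ʳ {n = suc _} v x = last-∷ʳ (tail v) x

expand-cong : ∀ n {u v} → u ≗ v → expand n u ≡ expand n v
expand-cong zero    u≗v = cong (λ d → digit d *ᵍ 1+i^ 0) (u≗v zero)
expand-cong (suc n) u≗v = cong₂ _+ᵍ_ (expand-cong n (u≗v ∘ inject₁))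
  (cong (λ d → digit d *ᵍ 1+i^ (suc n)) (u≗v (fromℕ (suc n))))

B-step : ∀ {k z e t} → B k z → (Σ Digit λ d → digit d *ᵍ 1+i^ (suc k) ≡ e) →
         z +ᵍ e ≡ t → B (suc k) t
B-step {k} (v , v↦z) (d , d↦e) z+e≡t = v ∷ʳ d ,
  trans (cong₂ _+ᵍ_ (trans (expand-cong k (init-∷ʳ v d)) v↦z)
                    (trans (cong (λ d′ → digit d′ *ᵍ 1+i^ (suc k)) (last-∷ʳ v d)) d↦e))
        z+e≡t

B-suc : ∀ {k z} → B k z → B (suc k) z
B-suc {k} {a , b} Bz =
  B-step Bz (d0 , digit-*ᵍ d0 (1+i^ (suc k))) (cong₂ _,_ (ℤP.+-identityʳ a) (ℤP.+-identityʳ b))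

digit∈B₀ : ∀ d → B 0 (digit d)
digit∈B₀ d = (λ _ → d) , *ᵍ-identityʳ (digit d)

-- Octagons

Region : Set₁
Region = ℕ → ℕ → Set

-- For x + y i ∈ Oct n with 2^(m+1) ∤ gcd(x, y), the pair (|x|, |y|) satisfies Oct₀ (2^m)
-- if n = 2m and Oct₁ (2^(m+1)) if n = 2m + 1.
Oct₀ : ℕ → Region
Oct₀ s a b = a < 3 * s × b < 3 * s × a + b < 4 * s ×
             ¬ (a ≡ 2 * s × b ≡ 0) × ¬ (a ≡ 0 × b ≡ 2 * s)

Oct₁ : ℕ → Region
Oct₁ s a b = a < 2 * s × b < 2 * s × a + b < 3 * s × ¬ (a ≡ s × b ≡ s)

Oct₀-swap : ∀ s {a b} → Oct₀ s a b → Oct₀ s b a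
Oct₀-swap s {a} {b} (a< , b< , a+b< , ¬2s,0 , ¬0,2s) =
  b< , a< , subst (_< 4 * s) (+-comm a b) a+b< , ¬0,2s ∘ swap , ¬2s,0 ∘ swap

Oct₁-swap : ∀ s {a b} → Oct₁ s a b → Oct₁ s b a
Oct₁-swap s {a} {b} (a< , b< , a+b< , ¬s,s) =
  b< , a< , subst (_< 3 * s) (+-comm a b) a+b< , ¬s,s ∘ swap

private
  s≤2s : ∀ s → s ≤ 2 * s
  s≤2s s = m≤m+n s (s + 0)

  2s≤3s : ∀ s → 2 * s ≤ 3 * s
  2s≤3s s = *-monoˡ-≤ s (n≤1+n 2)

  s+s≡2s : ∀ s → s + s ≡ 2 * s
  s+s≡2s = solve-∀

  2s+s≡3s : ∀ s → 2 * s + s ≡ 3 * s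
  2s+s≡3s = solve-∀

  2s+2s≡4s : ∀ s → 2 * s + 2 * s ≡ 4 * s
  2s+2s≡4s = solve-∀

  half-< : ∀ {m n} → m + m < n + n → m < n
  half-< {m} {n} h = ≰⇒> λ n≤m → <⇒≱ h (+-mono-≤ n≤m n≤m)

∣m+n-m∣≡n : ∀ m n → ℕ.∣ m + n - m ∣ ≡ n
∣m+n-m∣≡n m n = trans (∣-∣-comm (m + n) m) (∣m-m+n∣≡n m n)

a<2s⇒Oct₀ : ∀ s {a b} → b ≤ a → a < 2 * s → Oct₀ s a b
a<2s⇒Oct₀ s {a} {b} b≤a a<2s =
  <-≤-trans a<2s (2s≤3s s) , <-≤-trans b<2s (2s≤3s s) ,
  subst (a + b <_) (2s+2s≡4s s) (+-mono-< a<2s b<2s) ,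
  (λ (a≡2s , _) → <⇒≢ a<2s a≡2s) , (λ (_ , b≡2s) → <⇒≢ b<2s b≡2s)
  where
  b<2s : b < 2 * s
  b<2s = ≤-<-trans b≤a a<2s

Oct₁[2s+c,b]⇒Oct₀[c,b] : ∀ s {c b} → b ≤ 2 * s + c → Oct₁ (2 * s) (2 * s + c) b → Oct₀ s c b
Oct₁[2s+c,b]⇒Oct₀[c,b] s {c} {b} b≤a (a<4s , _ , a+b<6s , ¬2s,2s) =
  <-≤-trans c<2s (2s≤3s s) , b<3s , c+b<4s ,
  (λ (c≡2s , _) → <⇒≢ c<2s c≡2s) ,
  (λ (c≡0 , b≡2s) → ¬2s,2s (trans (cong (λ c′ → 2 * s + c′) c≡0) (+-identityʳ (2 * s)) , b≡2s))
  where
  2[2s]≡2s+2s : ∀ s → 2 * (2 * s) ≡ 2 * s + 2 * s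
  2[2s]≡2s+2s = solve-∀
  3[2s]≡3s+3s : ∀ s → 3 * (2 * s) ≡ 3 * s + 3 * s
  3[2s]≡3s+3s = solve-∀
  3[2s]≡2s+4s : ∀ s → 3 * (2 * s) ≡ 2 * s + 4 * s
  3[2s]≡2s+4s = solve-∀
  c<2s : c < 2 * s
  c<2s = +-cancelˡ-< (2 * s) c (2 * s) (subst ((2 * s + c) <_) (2[2s]≡2s+2s s) a<4s)
  b<3s : b < 3 * s
  b<3s = half-< (≤-<-trans (+-monoˡ-≤ b b≤a)
                           (subst ((2 * s + c + b) <_) (3[2s]≡3s+3s s) a+b<6s))
  c+b<4s : c + b < 4 * s
  c+b<4s = +-cancelˡ-< (2 * s) (c + b) (4 * s)
                       (subst₂ _<_ (+-assoc (2 * s) c b) (3[2s]≡2s+4s s) a+b<6s)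

Oct₁-reduce-≤ : ∀ s {a b} → b ≤ a → Oct₁ (2 * s) a b →
                Oct₀ s a b ⊎ Oct₀ s ℕ.∣ a - 2 * s ∣ b
Oct₁-reduce-≤ s {a} {b} b≤a h with a <? 2 * s
... | yes a<2s = inj₁ (a<2s⇒Oct₀ s b≤a a<2s)
... | no a≮2s with m≤n⇒∃[o]m+o≡n (≮⇒≥ a≮2s)
...   | c , refl = inj₂ (subst (λ c′ → Oct₀ s c′ b) (sym (∣m+n-m∣≡n (2 * s) c))
                              (Oct₁[2s+c,b]⇒Oct₀[c,b] s b≤a h))

Oct₁-reduce : ∀ s {a b} → Oct₁ (2 * s) a b →
              Oct₀ s a b ⊎ Oct₀ s ℕ.∣ a - 2 * s ∣ b ⊎ Oct₀ s a ℕ.∣ b - 2 * s ∣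
Oct₁-reduce s {a} {b} h with ≤-total b a
... | inj₁ b≤a = map₂ inj₁ (Oct₁-reduce-≤ s b≤a h)
... | inj₂ a≤b = [ inj₁ ∘ Oct₀-swap s , inj₂ ∘ inj₂ ∘ Oct₀-swap s ]
                   (Oct₁-reduce-≤ s a≤b (Oct₁-swap (2 * s) h))

a<2s⇒Oct₁ : ∀ s {a b} → b < s → a < 2 * s → Oct₁ s a b
a<2s⇒Oct₁ s {a} {b} b<s a<2s =
  a<2s , <-≤-trans b<s (s≤2s s) , subst (a + b <_) (2s+s≡3s s) (+-mono-< a<2s b<s) ,
  (λ (_ , b≡s) → <⇒≢ b<s b≡s)

Oct₀[s+a,s+b]⇒Oct₁[a,b] : ∀ s {a b} → Oct₀ s (s + a) (s + b) → Oct₁ s a b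
Oct₀[s+a,s+b]⇒Oct₁[a,b] s {a} {b} (_ , _ , sum<4s , _) =
  ≤-<-trans (m≤m+n a b) a+b<2s , ≤-<-trans (m≤n+m b a) a+b<2s , <-≤-trans a+b<2s (2s≤3s s) ,
  (λ (a≡s , b≡s) → <⇒≢ a+b<2s (trans (cong₂ _+_ a≡s b≡s) (s+s≡2s s)))
  where
  [s+a]+[s+b]≡2s+[a+b] : ∀ s a b → s + a + (s + b) ≡ 2 * s + (a + b)
  [s+a]+[s+b]≡2s+[a+b] = solve-∀
  a+b<2s : a + b < 2 * s
  a+b<2s = +-cancelˡ-< (2 * s) (a + b) (2 * s)
    (subst₂ _<_ ([s+a]+[s+b]≡2s+[a+b] s a b) (sym (2s+2s≡4s s)) sum<4s)

Oct₀[s+a,b]⇒Oct₁[a,s∸b] : ∀ s {a b} → b < s → Oct₀ s (s + a) b → Oct₁ s a (s ∸ b)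
Oct₀[s+a,b]⇒Oct₁[a,s∸b] s {a} {b} b<s (a<3s , _ , _ , ¬2s,0 , _) = a<2s , e<2s , a+e<3s , excl
  where
  e : ℕ
  e = s ∸ b
  b+e≡s : b + e ≡ s
  b+e≡s = m+[n∸m]≡n (<⇒≤ b<s)
  a<2s : a < 2 * s
  a<2s = +-cancelˡ-< s a (2 * s) a<3s
  e<2s : e < 2 * s
  e<2s = ≤-<-trans (m∸n≤m s b) (subst (s <_) (s+s≡2s s) (m<m+n s (≤-<-trans z≤n b<s)))
  a+e<3s : a + e < 3 * s
  a+e<3s = ≤-<-trans (+-monoʳ-≤ a (m∸n≤m s b)) (subst (_< 3 * s) (+-comm s a) a<3s)
  excl : ¬ (a ≡ s × e ≡ s)
  excl (a≡s , e≡s) = ¬2s,0 (trans (cong (λ a′ → s + a′) a≡s) (s+s≡2s s) ,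
                            +-cancelʳ-≡ s b 0 (trans (cong (λ e′ → b + e′) (sym e≡s)) b+e≡s))

Oct₀-reduce-≤ : ∀ s {a b} → b ≤ a → Oct₀ s a b → Oct₁ s a b ⊎ Oct₁ s ℕ.∣ a - s ∣ ℕ.∣ b - s ∣
Oct₀-reduce-≤ s {a} {b} b≤a h with s ≤? b
... | yes s≤b with m≤n⇒∃[o]m+o≡n (≤-trans s≤b b≤a) | m≤n⇒∃[o]m+o≡n s≤b
...   | a′ , refl | b′ , refl =
  inj₂ (subst₂ (Oct₁ s) (sym (∣m+n-m∣≡n s a′)) (sym (∣m+n-m∣≡n s b′))
               (Oct₀[s+a,s+b]⇒Oct₁[a,b] s h))
Oct₀-reduce-≤ s {a} {b} b≤a h | no s≰b with a <? 2 * s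
... | yes a<2s = inj₁ (a<2s⇒Oct₁ s (≰⇒> s≰b) a<2s)
... | no a≮2s with m≤n⇒∃[o]m+o≡n (≤-trans (s≤2s s) (≮⇒≥ a≮2s))
...   | a′ , refl =
  inj₂ (subst₂ (Oct₁ s) (sym (∣m+n-m∣≡n s a′)) (sym (m≤n⇒∣m-n∣≡n∸m (<⇒≤ (≰⇒> s≰b))))
               (Oct₀[s+a,b]⇒Oct₁[a,s∸b] s (≰⇒> s≰b) h))

Oct₀-reduce : ∀ s {a b} → Oct₀ s a b → Oct₁ s a b ⊎ Oct₁ s ℕ.∣ a - s ∣ ℕ.∣ b - s ∣
Oct₀-reduce s {a} {b} h with ≤-total b a
... | inj₁ b≤a = Oct₀-reduce-≤ s b≤a h
... | inj₂ a≤b = map (Oct₁-swap s) (Oct₁-swap s) (Oct₀-reduce-≤ s a≤b (Oct₀-swap s h))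

-- Covering the octagons by expansions

_⊆B_ : Region → ℕ → Set
R ⊆B k = ∀ {x y} → R ∣ x ∣ ∣ y ∣ → B k (x , y)

recentre : ℕ → ℤ → ℤ
recentre n x = x ℤ.- (sign x ◃ n)

∣⊖∣≡∣-∣ : ∀ m n → ∣ m ⊖ n ∣ ≡ ℕ.∣ m - n ∣
∣⊖∣≡∣-∣ m n with ≤-total m n
... | inj₁ m≤n = trans (ℤP.∣⊖∣-≤ m≤n) (sym (m≤n⇒∣m-n∣≡n∸m m≤n))
... | inj₂ n≤m = trans (cong ∣_∣ (ℤP.⊖-≥ n≤m)) (sym (m≤n⇒∣n-m∣≡n∸m n≤m))

∣recentre∣ : ∀ n x → ∣ recentre n x ∣ ≡ ℕ.∣ ∣ x ∣ - n ∣
∣recentre∣ n (+ a) =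
  trans (cong (λ c → ∣ + a ℤ.- c ∣) (ℤP.+◃n≡+n n))
        (trans (cong ∣_∣ (ℤP.m-n≡m⊖n a n)) (∣⊖∣≡∣-∣ a n))
∣recentre∣ n -[1+ a ] =
  trans (cong (λ c → ∣ -[1+ a ] ℤ.+ c ∣) (trans (neg-◃ Sign.- n) (ℤP.+◃n≡+n n)))
        (trans (∣⊖∣≡∣-∣ n (suc a)) (∣-∣-comm n (suc a)))

i-j+j≡i : ∀ i j → i ℤ.- j ℤ.+ j ≡ i
i-j+j≡i = ℤ-Solver.solve-∀

recentre-+ : ∀ n x → recentre n x ℤ.+ (sign x ◃ n) ≡ x
recentre-+ n x = i-j+j≡i x (sign x ◃ n)

axial-step : ∀ {s k} → Axial (2 * s) (1+i^ (suc k)) → Oct₀ s ⊆B k → Oct₁ (2 * s) ⊆B suc k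
axial-step {s} P Oct₀⊆B {x} {y} h with Oct₁-reduce s h
... | inj₁ h′ = B-suc (Oct₀⊆B h′)
... | inj₂ (inj₁ h′) =
  B-step (Oct₀⊆B {recentre (2 * s) x} {y}
                  (subst (λ a → Oct₀ s a ∣ y ∣) (sym (∣recentre∣ (2 * s) x)) h′))
         (axial-digit P (real (sign x)))
         (cong₂ _,_ (recentre-+ (2 * s) x) (ℤP.+-identityʳ y))
... | inj₂ (inj₂ h′) =
  B-step (Oct₀⊆B {x} {recentre (2 * s) y}
                  (subst (Oct₀ s ∣ x ∣) (sym (∣recentre∣ (2 * s) y)) h′))
         (axial-digit P (imag (sign y)))
         (cong₂ _,_ (ℤP.+-identityʳ x) (recentre-+ (2 * s) y))

diagonal-step : ∀ {s k} → Axial s (1+i^ k) → Oct₁ s ⊆B k → Oct₀ s ⊆B suc k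
diagonal-step {s} P Oct₁⊆B {x} {y} h with Oct₀-reduce s h
... | inj₁ h′ = B-suc (Oct₁⊆B h′)
... | inj₂ h′ =
  B-step (Oct₁⊆B {recentre s x} {recentre s y}
                  (subst₂ (Oct₁ s) (sym (∣recentre∣ s x)) (sym (∣recentre∣ s y)) h′))
         (diagonal-digit P (sign x) (sign y))
         (cong₂ _,_ (recentre-+ s x) (recentre-+ s y))

Oct₁-1⊆B₀ : Oct₁ 1 ⊆B 0
Oct₁-1⊆B₀ {+ 0}       {+ 0}       _ = digit∈B₀ d0
Oct₁-1⊆B₀ {+ 1}       {+ 0}       _ = digit∈B₀ d1
Oct₁-1⊆B₀ { -[1+ 0 ]} {+ 0}       _ = digit∈B₀ d-1
Oct₁-1⊆B₀ {+ 0}       {+ 1}       _ = digit∈B₀ di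
Oct₁-1⊆B₀ {+ 0}       { -[1+ 0 ]} _ = digit∈B₀ d-i
Oct₁-1⊆B₀ {+ 1}       {+ 1}       (_ , _ , _ , ¬1,1) = ⊥-elim (¬1,1 (refl , refl))
Oct₁-1⊆B₀ {+ 1}       { -[1+ 0 ]} (_ , _ , _ , ¬1,1) = ⊥-elim (¬1,1 (refl , refl))
Oct₁-1⊆B₀ { -[1+ 0 ]} {+ 1}       (_ , _ , _ , ¬1,1) = ⊥-elim (¬1,1 (refl , refl))
Oct₁-1⊆B₀ { -[1+ 0 ]} { -[1+ 0 ]} (_ , _ , _ , ¬1,1) = ⊥-elim (¬1,1 (refl , refl))
Oct₁-1⊆B₀ {+ suc (suc _)}     (s≤s (s≤s ()) , _)
Oct₁-1⊆B₀ { -[1+ suc _ ]}     (s≤s (s≤s ()) , _)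
Oct₁-1⊆B₀ {y = + suc (suc _)} (_ , s≤s (s≤s ()) , _)
Oct₁-1⊆B₀ {y = -[1+ suc _ ]}  (_ , s≤s (s≤s ()) , _)

Oct₁-covered : ∀ m → Oct₁ (2 ^ m) ⊆B double m
Oct₀-covered : ∀ m → Oct₀ (2 ^ m) ⊆B suc (double m)
Oct₁-covered zero    = Oct₁-1⊆B₀
Oct₁-covered (suc m) = axial-step {2 ^ m} (1+i^double-axial (suc m)) (Oct₀-covered m)
Oct₀-covered m       = diagonal-step (1+i^double-axial m) (Oct₁-covered m)

private
  c*[2*x]≡2*[c*x] : ∀ c x → c * (2 * x) ≡ 2 * (c * x)
  c*[2*x]≡2*[c*x] = solve-∀

-- suc (suc n) % 2 reduces to n % 2, so one case split on n % 2 unfolds both sides.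
w-suc-suc : ∀ n → w (suc (suc n)) ≡ 2 * w n
w-suc-suc n with n % 2
... | zero  = c*[2*x]≡2*[c*x] 3 (2 ^ ⌊ n /2⌋)
... | suc _ = c*[2*x]≡2*[c*x] 4 (2 ^ ⌊ n /2⌋)

w≤2^[2+⌊n/2⌋] : ∀ n → w n ≤ 2 ^ (2 + ⌊ n /2⌋)
w≤2^[2+⌊n/2⌋] n with n % 2
... | zero  = ≤-trans (*-monoˡ-≤ (2 ^ ⌊ n /2⌋) (n≤1+n 3))
                      (≤-reflexive (*-assoc 2 2 (2 ^ ⌊ n /2⌋)))
... | suc _ = ≤-reflexive (*-assoc 2 2 (2 ^ ⌊ n /2⌋))

w-double : ∀ m → w (double m) ≡ 3 * 2 ^ m
w-double zero    = refl
w-double (suc m) = trans (w-suc-suc (double m))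
  (trans (cong (2 *_) (w-double m)) (sym (c*[2*x]≡2*[c*x] 3 (2 ^ m))))

w-suc-double : ∀ m → w (suc (double m)) ≡ 2 * 2 ^ suc m
w-suc-double zero    = refl
w-suc-double (suc m) = trans (w-suc-suc (suc (double m))) (cong (2 *_) (w-suc-double m))

parity : ∀ n → n ≡ double ⌊ n /2⌋ ⊎ n ≡ suc (double ⌊ n /2⌋)
parity zero          = inj₁ refl
parity (suc zero)    = inj₂ refl
parity (suc (suc n)) = map (cong (λ k → suc (suc k))) (cong (λ k → suc (suc k))) (parity n)

-- 2-adic valuations

^-monoʳ-∣ : ∀ m {i j} → i ≤ j → m ^ i ∣ m ^ j
^-monoʳ-∣ m {i} i≤j with m≤n⇒∃[o]m+o≡n i≤j
... | d , refl = subst (m ^ i ∣_) (sym (^-distribˡ-+-* m i d)) (m∣m*n (m ^ d))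

^-cancelʳ-< : ∀ m .{{_ : ℕ.NonZero m}} {i j} → m ^ i < m ^ j → i < j
^-cancelʳ-< m m^i<m^j = ≰⇒> λ j≤i → <⇒≱ m^i<m^j (^-monoʳ-≤ m j≤i)

^-cancelʳ-∣ : ∀ m .{{_ : ℕ.NonZero m}} → 1 < m → ∀ {i j} → m ^ i ∣ m ^ j → i ≤ j
^-cancelʳ-∣ m 1<m {j = j} m^i∣m^j =
  ≮⇒≥ λ j<i → <⇒≱ (^-monoʳ-< m 1<m j<i) (∣⇒≤ {{m^n≢0 m j}} m^i∣m^j)

∥2^⇒≡ : ∀ {l g k} → l ∥ (+ g) → g ≡ 2 ^ k → l ≡ k
∥2^⇒≡ (2^l∣ , 2^[1+l]∤) refl =
  ≤-antisym (^-cancelʳ-∣ 2 (n<1+n 1) 2^l∣) (≮⇒≥ λ l<k → 2^[1+l]∤ (^-monoʳ-∣ 2 l<k))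

gcd-idem : ∀ n → ℕ.gcd n n ≡ n
gcd-idem n = ∣-antisym (gcd[m,n]∣m n n) (gcd-greatest ∣-refl ∣-refl)

2^∣⇒< : ∀ {l a k} → 2 ^ l ∣ a → a ≢ 0 → a < 2 ^ k → l < k
2^∣⇒< 2^l∣a a≢0 a<2^k = ^-cancelʳ-< 2 (≤-<-trans (∣⇒≤ {{ℕ.≢-nonZero a≢0}} 2^l∣a) a<2^k)

∥⇒< : ∀ {l k x y} → l ∥ gcd x y → (x , y) ≢ 0ᵍ → ∣ x ∣ < 2 ^ k → ∣ y ∣ < 2 ^ k → l < k
∥⇒< {x = x} {y} (2^l∣gcd , _) xy≢0 x< y< with ∣ x ∣ ℕ.≟ 0 | ∣ y ∣ ℕ.≟ 0
... | no x≢0  | _        = 2^∣⇒< (∣-trans 2^l∣gcd (gcd[m,n]∣m ∣ x ∣ ∣ y ∣)) x≢0 x<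
... | yes _   | no y≢0   = 2^∣⇒< (∣-trans 2^l∣gcd (gcd[m,n]∣n ∣ x ∣ ∣ y ∣)) y≢0 y<
... | yes x≡0 | yes y≡0 = ⊥-elim (xy≢0 (cong₂ _,_ (ℤP.∣i∣≡0⇒i≡0 x≡0) (ℤP.∣i∣≡0⇒i≡0 y≡0)))

+≤+-+⇒< : ∀ {a c d} → + a ℤ.≤ + c ℤ.- + suc d → a < c
+≤+-+⇒< {a} {c} {d} a≤c-d = <-≤-trans (m<m+n a (s≤s z≤n)) (ℤP.drop‿+≤+
  (subst (+ a ℤ.+ + suc d ℤ.≤_) (i-j+j≡i (+ c) (+ suc d)) (ℤP.+-monoˡ-≤ (+ suc d) a≤c-d)))

Oct⇒< : ∀ n x y → Oct n (x , y) → ∣ x ∣ < w n × ∣ y ∣ < w n × ∣ x ∣ + ∣ y ∣ < w (suc n)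
Oct⇒< _ _ _ (x≤ , y≤ , x+y≤) = +≤+-+⇒< x≤ , +≤+-+⇒< y≤ , +≤+-+⇒< x+y≤

Oct-double⇒Oct₀ : ∀ {m l} x y → Oct (double m) (x , y) → l ∥ gcd x y → l ≢ suc m →
                  Oct₀ (2 ^ m) ∣ x ∣ ∣ y ∣
Oct-double⇒Oct₀ {m} x y oct l∥ l≢ =
  let x< , y< , x+y< = Oct⇒< (double m) x y oct in
  subst (∣ x ∣ <_) (w-double m) x< , subst (∣ y ∣ <_) (w-double m) y< ,
  subst (∣ x ∣ + ∣ y ∣ <_) (trans (w-suc-double m) (sym (*-assoc 2 2 (2 ^ m)))) x+y< ,
  (λ (x≡ , y≡) → l≢ (∥2^⇒≡ l∥ (trans (cong₂ ℕ.gcd x≡ y≡) (gcd-identityʳ _)))) ,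
  (λ (x≡ , y≡) → l≢ (∥2^⇒≡ l∥ (trans (cong₂ ℕ.gcd x≡ y≡) (gcd-identityˡ _))))

Oct-suc-double⇒Oct₁ : ∀ {m l} x y → Oct (suc (double m)) (x , y) → l ∥ gcd x y → l ≢ suc m →
                      Oct₁ (2 ^ suc m) ∣ x ∣ ∣ y ∣
Oct-suc-double⇒Oct₁ {m} x y oct l∥ l≢ =
  let x< , y< , x+y< = Oct⇒< (suc (double m)) x y oct in
  subst (∣ x ∣ <_) (w-suc-double m) x< , subst (∣ y ∣ <_) (w-suc-double m) y< ,
  subst (∣ x ∣ + ∣ y ∣ <_) (w-double (suc m)) x+y< ,
  (λ (x≡ , y≡) → l≢ (∥2^⇒≡ l∥ (trans (cong₂ ℕ.gcd x≡ y≡) (gcd-idem _))))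

corollary2p15 : (n : ℕ) (x y : ℤ) → Oct n (x , y) → (x , y) ≢ 0ᵍ →
    (l : ℕ) → l ∥ gcd x y → l ≢ suc ⌊ n /2⌋ →
    (l ≤ ⌊ n /2⌋) × B (suc n) (x , y)
corollary2p15 n x y oct xy≢0 l l∥ l≢ = l≤⌊n/2⌋ , x+yi∈B (parity n)
  where
  m : ℕ
  m = ⌊ n /2⌋

  <2^[2+m] : ∀ {a} → a < w n → a < 2 ^ (2 + m)
  <2^[2+m] a<w = <-≤-trans a<w (w≤2^[2+⌊n/2⌋] n)

  l≤⌊n/2⌋ : l ≤ m
  l≤⌊n/2⌋ = let x< , y< , _ = Oct⇒< n x y oct in
    ≤-pred (≤∧≢⇒< (≤-pred (∥⇒< l∥ xy≢0 (<2^[2+m] x<) (<2^[2+m] y<))) l≢)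

  x+yi∈B : n ≡ double m ⊎ n ≡ suc (double m) → B (suc n) (x , y)
  x+yi∈B (inj₁ n≡) = subst (λ k → B (suc k) (x , y)) (sym n≡)
    (Oct₀-covered m (Oct-double⇒Oct₀ x y (subst (λ k → Oct k (x , y)) n≡ oct) l∥ l≢))
  x+yi∈B (inj₂ n≡) = subst (λ k → B (suc k) (x , y)) (sym n≡)
    (Oct₁-covered (suc m) (Oct-suc-double⇒Oct₁ x y (subst (λ k → Oct k (x , y)) n≡ oct) l∥ l≢))
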